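{- Let $M$ be the doubling of a matroid $M_0$. Then $\chi(M)=\chi(M_0)$, and if $N$ is a matroid that is not a doubling of another matroid and $M_0$ contains no induced $N$-restriction, then neither does $M$.
   Context: A simple binary matroid (here just "matroid") is a pair $M=(E,G)$, where $G$ is identified with $\mathbb F_2^n\setminus\{0\}$ for some $n\ge0$ and $E\subseteq G$; $\dim(M)=n$. A flat of $G$ is a set $V\setminus\{0\}$ with $V$ a subspace, of dimension $\dim V$. $M$ contains $N=(F',G')$ as an induced restriction if there is an injective linear map $\varphi:G'\to G$ (linear on the underlying vector spaces) with $\varphi(F')=E\cap\varphi(G')$; isomorphism means such a bijective $\varphi$. The critical number $\chi(M)$ is the smallest $k\ge0$ such that $G\setminus E$ contains a flat of dimension $n-k$. The doubling of an $n$-dimensional matroid $(E,\mathbb F_2^n\setminus\{0\})$ is (up to isomorphism) the $(n+1)$-dimensional matroid $(\{0,1\}\times E,\mathbb F_2^{n+1}\setminus\{0\})$; equivalently, $M=(E,G)$ is the doubling of $M|H=(E\cap H,H)$ by $w$, for a hyperplane $H$ and $w\in G\setminus H$, if $w\notin E$ and $E=(E\cap H)\cup\{w+x:x\in E\cap H\}$. -}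

module Defs where

open import Data.Bool using (Bool; true; false; _xor_)
open import Data.Nat using (ℕ; suc; _+_; _<_)
open import Data.Vec using (Vec; _∷_; replicate; zipWith)
open import Data.Product using (Σ; _×_)
open import Relation.Binary.PropositionalEquality using (_≡_; _≢_)
open import Relation.Nullary using (¬_)
open import Function.Bundles using (_⇔_)

F2^ : ℕ → Set
F2^ n = Vec Bool n

0v : ∀ {n} → F2^ n
0v {n} = replicate n false

_⊕_ : ∀ {n} → F2^ n → F2^ n → F2^ n
_⊕_ = zipWith _xor_

-- Linear maps over 𝔽₂ (additivity is linearity, since the scalars are 0,1).
IsLinear : ∀ {m n} → (F2^ m → F2^ n) → Set
IsLinear f = ∀ x y → f (x ⊕ y) ≡ f x ⊕ f y

IsInjective : ∀ {m n} → (F2^ m → F2^ n) → Set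
IsInjective f = ∀ x y → f x ≡ f y → x ≡ y

IsSurjective : ∀ {m n} → (F2^ m → F2^ n) → Set
IsSurjective {m} f = ∀ y → Σ (F2^ m) λ x → f x ≡ y

-- A simple binary matroid of dimension n: G = 𝔽₂ⁿ ∖ {0}, E ⊆ G given by its
-- (decidable) indicator function, which must vanish at 0.
record Matroid (n : ℕ) : Set where
  field
    E      : F2^ n → Bool
    E-zero : E 0v ≡ false
open Matroid public

-- M contains N as an induced restriction via the linear map φ : G' → G
-- (φ(F') = E ∩ φ(G')); φ injective ⇒ this is: for nonzero x, x ∈ F' ⇔ φ x ∈ E.
RestrictsVia : ∀ {m n} → Matroid n → Matroid m → (F2^ m → F2^ n) → Set
RestrictsVia M N φ = ∀ x → x ≢ 0v → E N x ≡ E M (φ x)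

ContainsInduced : ∀ {m n} → Matroid n → Matroid m → Set
ContainsInduced {m} {n} M N =
  Σ (F2^ m → F2^ n) λ φ → IsLinear φ × IsInjective φ × RestrictsVia M N φ

Isomorphic : ∀ {m n} → Matroid n → Matroid m → Set
Isomorphic {m} {n} M N =
  Σ (F2^ m → F2^ n) λ φ →
    IsLinear φ × IsInjective φ × IsSurjective φ × RestrictsVia M N φ

-- G ∖ E contains a flat of dimension d: a d-dimensional subspace V (the image of
-- an injective linear map 𝔽₂ᵈ → 𝔽₂ⁿ) with V ∖ {0} disjoint from E.
HasFlatAvoiding : ∀ {n} → Matroid n → ℕ → Set
HasFlatAvoiding {n} M d =
  Σ (F2^ d → F2^ n) λ ψ →
    IsLinear ψ × IsInjective ψ × (∀ x → x ≢ 0v → E M (ψ x) ≡ false)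

-- χ(M) = k : k is the least number such that G ∖ E contains a flat of
-- dimension n − k.
IsCriticalNumber : ∀ {n} → Matroid n → ℕ → Set
IsCriticalNumber {n} M k =
  (Σ ℕ λ d → (d + k ≡ n) × HasFlatAvoiding M d)
  × (∀ j d → j < k → d + j ≡ n → ¬ HasFlatAvoiding M d)

-- The doubling of M₀ = (E, 𝔽₂ⁿ∖0): ({0,1} × E, 𝔽₂ⁿ⁺¹∖0), the new coordinate first.
double : ∀ {n} → Matroid n → Matroid (suc n)
double M₀ = record { E = λ { (b ∷ x) → E M₀ x } ; E-zero = E-zero M₀ }

IsDoublingOf : ∀ {n m} → Matroid n → Matroid m → Set
IsDoublingOf M M₀ = Isomorphic M (double M₀)

NotADoubling : ∀ {n} → Matroid n → Set
NotADoubling M = ∀ m (M₀ : Matroid m) → ¬ IsDoublingOf M M₀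

module Submission where

-- Write e₀ = (1,0,…,0) for the doubling direction: E (double M₀) is invariant under
-- translation by e₀ and projects onto E M₀ by dropping the first coordinate. A flat of M₀
-- avoiding E spans together with e₀ a flat of the doubling of one more dimension, still
-- avoiding E; conversely a flat of the doubling of dimension d + 1 contains a hyperplane
-- whose image misses e₀, and that hyperplane projects injectively onto a flat of M₀. So the
-- two matroids have flats of the same codimensions k ≤ dim M₀, hence the same critical
-- number. An induced restriction N of the doubling either misses e₀, and then projects
-- into M₀, or contains a preimage x₀ of e₀; then E N is invariant under translation by x₀,
-- and an automorphism sending e₀ to x₀ exhibits N as a doubling.

open import Defs
open import Data.Nat using (ℕ)
open import Data.Product using (_×_)
open import Relation.Nullary using (¬_)
open import Function.Bundles using (_⇔_)

open import Data.Nat using (zero; suc; _+_; _≤_; _<_; z≤n; s≤s)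
open import Data.Nat.Properties using (≤-antisym; ≤-refl; ≤-trans; <⇒≤; ≮⇒≥; 1+n≰n; suc-injective)
open import Data.Bool using (Bool; true; false; _xor_) renaming (_≟_ to _≟ᵇ_)
open import Data.Bool.Properties using (xor-assoc; xor-comm; xor-identityˡ; xor-identityʳ; xor-same)
open import Data.Vec using ([]; _∷_; head; tail)
open import Data.Vec.Properties
  using (≡-dec; ∷-injectiveʳ; zipWith-assoc; zipWith-comm; zipWith-identityˡ; zipWith-identityʳ)
open import Data.Product using (Σ; ∃; _,_; proj₁; proj₂)
open import Data.Sum using (_⊎_; inj₁; inj₂)
open import Data.Empty using (⊥-elim)
open import Function using (_∘_)
open import Function.Bundles using (mk⇔; module Equivalence)
open import Function.Construct.Composition using (_⇔-∘_)
open import Function.Construct.Symmetry using (⇔-sym)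
open import Relation.Nullary using (Dec; yes; no)
open import Relation.Nullary.Decidable using (map′; _⊎-dec_)
open import Relation.Binary.PropositionalEquality

⊕-assoc : ∀ {n} (x y z : F2^ n) → (x ⊕ y) ⊕ z ≡ x ⊕ (y ⊕ z)
⊕-assoc = zipWith-assoc xor-assoc

⊕-comm : ∀ {n} (x y : F2^ n) → x ⊕ y ≡ y ⊕ x
⊕-comm = zipWith-comm xor-comm

⊕-identityˡ : ∀ {n} (x : F2^ n) → 0v ⊕ x ≡ x
⊕-identityˡ = zipWith-identityˡ xor-identityˡ

⊕-identityʳ : ∀ {n} (x : F2^ n) → x ⊕ 0v ≡ x
⊕-identityʳ = zipWith-identityʳ xor-identityʳ

⊕-self : ∀ {n} (x : F2^ n) → x ⊕ x ≡ 0v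
⊕-self []      = refl
⊕-self (b ∷ x) = cong₂ _∷_ (xor-same b) (⊕-self x)

⊕-cancelˡ : ∀ {n} (x y : F2^ n) → x ⊕ (x ⊕ y) ≡ y
⊕-cancelˡ x y = begin
  x ⊕ (x ⊕ y)  ≡⟨ sym (⊕-assoc x x y) ⟩
  (x ⊕ x) ⊕ y  ≡⟨ cong (_⊕ y) (⊕-self x) ⟩
  0v ⊕ y       ≡⟨ ⊕-identityˡ y ⟩
  y            ∎
  where open ≡-Reasoning

⊕≡0v⇒≡ : ∀ {n} {x y : F2^ n} → x ⊕ y ≡ 0v → x ≡ y
⊕≡0v⇒≡ {x = x} {y} x⊕y≡0 = begin
  x            ≡⟨ sym (⊕-identityʳ x) ⟩
  x ⊕ 0v       ≡⟨ cong (x ⊕_) (sym x⊕y≡0) ⟩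
  x ⊕ (x ⊕ y)  ≡⟨ ⊕-cancelˡ x y ⟩
  y            ∎
  where open ≡-Reasoning

⊕-interchange : ∀ {n} (p q r s : F2^ n) → (p ⊕ q) ⊕ (r ⊕ s) ≡ (p ⊕ r) ⊕ (q ⊕ s)
⊕-interchange p q r s = begin
  (p ⊕ q) ⊕ (r ⊕ s)  ≡⟨ ⊕-assoc p q (r ⊕ s) ⟩
  p ⊕ (q ⊕ (r ⊕ s))  ≡⟨ cong (p ⊕_) (sym (⊕-assoc q r s)) ⟩
  p ⊕ ((q ⊕ r) ⊕ s)  ≡⟨ cong (λ u → p ⊕ (u ⊕ s)) (⊕-comm q r) ⟩
  p ⊕ ((r ⊕ q) ⊕ s)  ≡⟨ cong (p ⊕_) (⊕-assoc r q s) ⟩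
  p ⊕ (r ⊕ (q ⊕ s))  ≡⟨ sym (⊕-assoc p r (q ⊕ s)) ⟩
  (p ⊕ r) ⊕ (q ⊕ s)  ∎
  where open ≡-Reasoning

infix 25 _·_

_·_ : ∀ {n} → Bool → F2^ n → F2^ n
false · x = 0v
true  · x = x

·-distribʳ-xor : ∀ {n} a b (x : F2^ n) → (a xor b) · x ≡ a · x ⊕ b · x
·-distribʳ-xor false false x = sym (⊕-self 0v)
·-distribʳ-xor false true  x = sym (⊕-identityˡ x)
·-distribʳ-xor true  false x = sym (⊕-identityʳ x)
·-distribʳ-xor true  true  x = sym (⊕-self x)

_≟v_ : ∀ {n} (x y : F2^ n) → Dec (x ≡ y)
_≟v_ = ≡-dec _≟ᵇ_

F2^0-irrelevant : (x y : F2^ 0) → x ≡ y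
F2^0-irrelevant [] [] = refl

agree-off-0v⇒agree : ∀ {n} {A : Set} (f g : F2^ n → A) →
  (∀ x → x ≢ 0v → f x ≡ g x) → f 0v ≡ g 0v → ∀ x → f x ≡ g x
agree-off-0v⇒agree f g off-0v at-0v x with x ≟v 0v
... | yes refl = at-0v
... | no x≢0   = off-0v x x≢0

∃? : ∀ {k} (P : F2^ k → Set) → (∀ x → Dec (P x)) → Dec (∃ P)
∃? {zero}  P P? = map′ ([] ,_) (λ { ([] , p) → p }) (P? [])
∃? {suc k} P P? = map′ join split
  (∃? (P ∘ (false ∷_)) (P? ∘ (false ∷_)) ⊎-dec ∃? (P ∘ (true ∷_)) (P? ∘ (true ∷_)))
  where
  join : ∃ (P ∘ (false ∷_)) ⊎ ∃ (P ∘ (true ∷_)) → ∃ P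
  join (inj₁ (x , p)) = false ∷ x , p
  join (inj₂ (x , p)) = true ∷ x , p
  split : ∃ P → ∃ (P ∘ (false ∷_)) ⊎ ∃ (P ∘ (true ∷_))
  split (false ∷ x , p) = inj₁ (x , p)
  split (true ∷ x , p)  = inj₂ (x , p)

e₀ : ∀ {n} → F2^ (suc n)
e₀ = true ∷ 0v

e₀≢0v : ∀ {n} → e₀ {n} ≢ 0v
e₀≢0v ()

tail-⊕ : ∀ {n} (x y : F2^ (suc n)) → tail (x ⊕ y) ≡ tail x ⊕ tail y
tail-⊕ (_ ∷ _) (_ ∷ _) = refl

tail≡0v⇒0v⊎e₀ : ∀ {n} (v : F2^ (suc n)) → tail v ≡ 0v → v ≡ 0v ⊎ v ≡ e₀
tail≡0v⇒0v⊎e₀ (false ∷ x) x≡0 = inj₁ (cong (false ∷_) x≡0)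
tail≡0v⇒0v⊎e₀ (true ∷ x)  x≡0 = inj₂ (cong (true ∷_) x≡0)

E-double : ∀ {n} (M₀ : Matroid n) (v : F2^ (suc n)) → E (double M₀) v ≡ E M₀ (tail v)
E-double M₀ (_ ∷ _) = refl

E-double-⊕e₀ : ∀ {n} (M₀ : Matroid n) (v : F2^ (suc n)) →
  E (double M₀) (e₀ ⊕ v) ≡ E (double M₀) v
E-double-⊕e₀ M₀ (_ ∷ x) = cong (E M₀) (⊕-identityˡ x)

module _ {m n} {f : F2^ m → F2^ n} (f-linear : IsLinear f) where

  linear-0v : f 0v ≡ 0v
  linear-0v = begin
    f 0v          ≡⟨ cong f (sym (⊕-self 0v)) ⟩
    f (0v ⊕ 0v)   ≡⟨ f-linear 0v 0v ⟩
    f 0v ⊕ f 0v   ≡⟨ ⊕-self (f 0v) ⟩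
    0v            ∎
    where open ≡-Reasoning

  kernel-trivial⇒injective : (∀ x → f x ≡ 0v → x ≡ 0v) → IsInjective f
  kernel-trivial⇒injective ker x y fx≡fy = ⊕≡0v⇒≡ (ker (x ⊕ y) (begin
    f (x ⊕ y)    ≡⟨ f-linear x y ⟩
    f x ⊕ f y    ≡⟨ cong (_⊕ f y) fx≡fy ⟩
    f y ⊕ f y    ≡⟨ ⊕-self (f y) ⟩
    0v           ∎))
    where open ≡-Reasoning

  preimage-≢0v : ∀ {x y} → f x ≡ y → y ≢ 0v → x ≢ 0v
  preimage-≢0v fx≡y y≢0 x≡0 = y≢0 (trans (sym fx≡y) (trans (cong f x≡0) linear-0v))

  module _ (f-injective : IsInjective f) where

    embedding-kernel : ∀ x → f x ≡ 0v → x ≡ 0v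
    embedding-kernel x fx≡0 = f-injective x 0v (trans fx≡0 (sym linear-0v))

    embedding-≢0v : ∀ {x} → x ≢ 0v → f x ≢ 0v
    embedding-≢0v {x} x≢0 = x≢0 ∘ embedding-kernel x

∘-linear : ∀ {a b c} {f : F2^ b → F2^ c} {g : F2^ a → F2^ b} →
  IsLinear f → IsLinear g → IsLinear (f ∘ g)
∘-linear {f = f} f-linear g-linear x y = trans (cong f (g-linear x y)) (f-linear _ _)

∘-injective : ∀ {a b c} {f : F2^ b → F2^ c} {g : F2^ a → F2^ b} →
  IsInjective f → IsInjective g → IsInjective (f ∘ g)
∘-injective f-injective g-injective x y = g-injective x y ∘ f-injective _ _

tail∘-linear : ∀ {m n} {f : F2^ m → F2^ (suc n)} → IsLinear f → IsLinear (tail ∘ f)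
tail∘-linear {f = f} f-linear x y = trans (cong tail (f-linear x y)) (tail-⊕ (f x) (f y))

tail∘-injective : ∀ {m n} {f : F2^ m → F2^ (suc n)} → IsLinear f → IsInjective f →
  (∀ x → f x ≢ e₀) → IsInjective (tail ∘ f)
tail∘-injective {f = f} f-linear f-injective avoids-e₀ =
  kernel-trivial⇒injective (tail∘-linear f-linear) kernel
  where
  kernel : ∀ x → tail (f x) ≡ 0v → x ≡ 0v
  kernel x tail-fx≡0 with tail≡0v⇒0v⊎e₀ (f x) tail-fx≡0
  ... | inj₁ fx≡0  = embedding-kernel f-linear f-injective x fx≡0
  ... | inj₂ fx≡e₀ = ⊥-elim (avoids-e₀ x fx≡e₀)

cons-map : ∀ {m n} → (F2^ m → F2^ n) → F2^ (suc m) → F2^ (suc n)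
cons-map f (b ∷ x) = b ∷ f x

cons-map-linear : ∀ {m n} {f : F2^ m → F2^ n} → IsLinear f → IsLinear (cons-map f)
cons-map-linear f-linear (_ ∷ x) (_ ∷ y) = cong (_ ∷_) (f-linear x y)

cons-map-injective : ∀ {m n} {f : F2^ m → F2^ n} → IsInjective f → IsInjective (cons-map f)
cons-map-injective f-injective (a ∷ x) (b ∷ y) eq =
  cong₂ _∷_ (cong head eq) (f-injective x y (∷-injectiveʳ eq))

-- Linear automorphisms

record Automorphism (n : ℕ) : Set where
  field
    to       : F2^ n → F2^ n
    from     : F2^ n → F2^ n
    linear   : IsLinear to
    inverseˡ : ∀ x → from (to x) ≡ x
    inverseʳ : ∀ y → to (from y) ≡ y

  injective : IsInjective to
  injective x y tox≡toy = trans (sym (inverseˡ x)) (trans (cong from tox≡toy) (inverseˡ y))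

  surjective : IsSurjective to
  surjective y = from y , inverseʳ y

involution : ∀ {n} {f : F2^ n → F2^ n} → IsLinear f → (∀ x → f (f x) ≡ x) → Automorphism n
involution {f = f} f-linear f∘f≡id =
  record { to = f ; from = f ; linear = f-linear ; inverseˡ = f∘f≡id ; inverseʳ = f∘f≡id }

_∘-aut_ : ∀ {n} → Automorphism n → Automorphism n → Automorphism n
θ ∘-aut η = record
  { to       = θ.to ∘ η.to
  ; from     = η.from ∘ θ.from
  ; linear   = ∘-linear θ.linear η.linear
  ; inverseˡ = λ x → trans (cong η.from (θ.inverseˡ (η.to x))) (η.inverseˡ x)
  ; inverseʳ = λ y → trans (cong θ.to (η.inverseʳ (θ.from y))) (θ.inverseʳ y)
  }
  where
  module θ = Automorphism θ
  module η = Automorphism η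

cons-aut : ∀ {n} → Automorphism n → Automorphism (suc n)
cons-aut θ = record
  { to       = cons-map θ.to
  ; from     = cons-map θ.from
  ; linear   = cons-map-linear θ.linear
  ; inverseˡ = λ { (b ∷ x) → cong (b ∷_) (θ.inverseˡ x) }
  ; inverseʳ = λ { (b ∷ y) → cong (b ∷_) (θ.inverseʳ y) }
  }
  where module θ = Automorphism θ

swap-aut : ∀ {n} → Automorphism (suc (suc n))
swap-aut = involution {f = swap}
  (λ { (_ ∷ _ ∷ _) (_ ∷ _ ∷ _) → refl }) (λ { (_ ∷ _ ∷ _) → refl })
  where
  swap : ∀ {n} → F2^ (suc (suc n)) → F2^ (suc (suc n))
  swap (a ∷ b ∷ x) = b ∷ a ∷ x

transvection : ∀ {n} → F2^ n → Automorphism (suc n)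
transvection y = involution {f = τ} τ-linear
  (λ { (b ∷ x) → cong (b ∷_) (⊕-cancelˡ (b · y) x) })
  where
  τ : F2^ (suc _) → F2^ (suc _)
  τ (b ∷ x) = b ∷ (b · y ⊕ x)
  τ-linear : IsLinear τ
  τ-linear (a ∷ x) (b ∷ z) = cong ((a xor b) ∷_) (begin
    (a xor b) · y ⊕ (x ⊕ z)        ≡⟨ cong (_⊕ (x ⊕ z)) (·-distribʳ-xor a b y) ⟩
    (a · y ⊕ b · y) ⊕ (x ⊕ z)      ≡⟨ ⊕-interchange (a · y) (b · y) x z ⟩
    (a · y ⊕ x) ⊕ (b · y ⊕ z)      ∎)
    where open ≡-Reasoning

-- A leading 1 is handled by a transvection; otherwise swap the first two coordinates and
-- recurse on the tail.
automorphism-e₀↦ : ∀ {n} (x : F2^ (suc n)) → x ≢ 0v →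
  Σ (Automorphism (suc n)) λ θ → Automorphism.to θ e₀ ≡ x
automorphism-e₀↦ (true ∷ y) _ = transvection y , cong (true ∷_) (⊕-identityʳ y)
automorphism-e₀↦ {zero} (false ∷ []) x≢0 = ⊥-elim (x≢0 refl)
automorphism-e₀↦ {suc n} (false ∷ y) x≢0 with automorphism-e₀↦ y (x≢0 ∘ cong (false ∷_))
... | θ , θe₀≡y = cons-aut θ ∘-aut swap-aut , cong (false ∷_) θe₀≡y

-- ψ hits e₀ at most once, say at x₀; take the image of the coordinate hyperplane under an
-- automorphism sending e₀ to x₀.
hyperplane-avoiding-e₀ : ∀ {d n} {ψ : F2^ (suc d) → F2^ (suc n)} → IsLinear ψ → IsInjective ψ →
  Σ (F2^ d → F2^ (suc d)) λ a → IsLinear a × IsInjective a × (∀ z → ψ (a z) ≢ e₀)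
hyperplane-avoiding-e₀ {ψ = ψ} ψ-linear ψ-injective with ∃? (λ x → ψ x ≡ e₀) (λ x → ψ x ≟v e₀)
... | no ∄x = (false ∷_) , (λ _ _ → refl) , (λ _ _ → ∷-injectiveʳ) , λ z → ∄x ∘ (false ∷ z ,_)
... | yes (x₀ , ψx₀≡e₀) with automorphism-e₀↦ x₀ (preimage-≢0v ψ-linear ψx₀≡e₀ e₀≢0v)
...   | θ , θe₀≡x₀ =
  to ∘ (false ∷_) , ∘-linear linear (λ _ _ → refl) , ∘-injective injective (λ _ _ → ∷-injectiveʳ) ,
  λ z ψθz≡e₀ → false∷≢e₀ (injective _ _ (ψ-injective _ _ (trans ψθz≡e₀ (sym ψθe₀≡e₀))))
  where
  open Automorphism θ
  ψθe₀≡e₀ : ψ (to e₀) ≡ e₀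
  ψθe₀≡e₀ = trans (cong ψ θe₀≡x₀) ψx₀≡e₀
  false∷≢e₀ : ∀ {z} → false ∷ z ≢ e₀
  false∷≢e₀ ()

embedding⇒dim≤ : ∀ {m n} {f : F2^ m → F2^ n} → IsLinear f → IsInjective f → m ≤ n
embedding⇒dim≤ {zero} _ _ = z≤n
embedding⇒dim≤ {suc m} {zero} {f} _ f-injective =
  ⊥-elim (e₀≢0v (f-injective e₀ 0v (F2^0-irrelevant _ _)))
embedding⇒dim≤ {suc m} {suc n} {f} f-linear f-injective
  with hyperplane-avoiding-e₀ f-linear f-injective
... | a , a-linear , a-injective , avoids-e₀ = s≤s (embedding⇒dim≤ (tail∘-linear fa-linear)
  (tail∘-injective fa-linear (∘-injective f-injective a-injective) avoids-e₀))
  where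
  fa-linear : IsLinear (f ∘ a)
  fa-linear = ∘-linear f-linear a-linear

restricts-everywhere : ∀ {m n} (M : Matroid n) (N : Matroid m) {φ : F2^ m → F2^ n} →
  IsLinear φ → RestrictsVia M N φ → ∀ x → E N x ≡ E M (φ x)
restricts-everywhere M N {φ} φ-linear restricts = agree-off-0v⇒agree (E N) (E M ∘ φ) restricts
  (trans (E-zero N) (sym (trans (cong (E M) (linear-0v φ-linear)) (E-zero M))))

ContainsInduced-trans : ∀ {l m n} (M : Matroid n) (N : Matroid m) (L : Matroid l) →
  ContainsInduced M N → ContainsInduced N L → ContainsInduced M L
ContainsInduced-trans _ _ _
  (φ , φ-linear , φ-injective , φ-restricts) (ψ , ψ-linear , ψ-injective , ψ-restricts) =
  φ ∘ ψ , ∘-linear φ-linear ψ-linear , ∘-injective φ-injective ψ-injective ,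
  λ x x≢0 → trans (ψ-restricts x x≢0) (φ-restricts (ψ x) (embedding-≢0v ψ-linear ψ-injective x≢0))

Isomorphic⇒ContainsInduced : ∀ {m n} (M : Matroid n) (N : Matroid m) →
  Isomorphic M N → ContainsInduced M N
Isomorphic⇒ContainsInduced _ _ (φ , φ-linear , φ-injective , _ , φ-restricts) =
  φ , φ-linear , φ-injective , φ-restricts

Isomorphic-sym : ∀ {m n} (M : Matroid n) (N : Matroid m) → Isomorphic M N → Isomorphic N M
Isomorphic-sym {m} {n} M N (φ , φ-linear , φ-injective , φ-surjective , φ-restricts) =
  g , g-linear , g-injective , (λ x → φ x , φ-injective _ _ (φ∘g (φ x))) ,
  λ y y≢0 → sym (trans (φ-restricts (g y) (embedding-≢0v g-linear g-injective y≢0))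
                       (cong (E M) (φ∘g y)))
  where
  g : F2^ n → F2^ m
  g = proj₁ ∘ φ-surjective
  φ∘g : ∀ y → φ (g y) ≡ y
  φ∘g = proj₂ ∘ φ-surjective
  g-linear : IsLinear g
  g-linear x y = φ-injective _ _ (begin
    φ (g (x ⊕ y))        ≡⟨ φ∘g (x ⊕ y) ⟩
    x ⊕ y                ≡⟨ sym (cong₂ _⊕_ (φ∘g x) (φ∘g y)) ⟩
    φ (g x) ⊕ φ (g y)    ≡⟨ sym (φ-linear (g x) (g y)) ⟩
    φ (g x ⊕ g y)        ∎)
    where open ≡-Reasoning
  g-injective : IsInjective g
  g-injective x y gx≡gy = trans (sym (φ∘g x)) (trans (cong φ gx≡gy) (φ∘g y))

Isomorphic⇒dim≡ : ∀ {m n} (M : Matroid n) (N : Matroid m) → Isomorphic M N → m ≡ n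
Isomorphic⇒dim≡ M N M≅N@(_ , φ-linear , φ-injective , _) with Isomorphic-sym M N M≅N
... | _ , g-linear , g-injective , _ =
  ≤-antisym (embedding⇒dim≤ φ-linear φ-injective) (embedding⇒dim≤ g-linear g-injective)

-- Flats and the critical number

HasFlatAvoiding-zero : ∀ {n} (M : Matroid n) → HasFlatAvoiding M 0
HasFlatAvoiding-zero M =
  (λ _ → 0v) , (λ { [] [] → sym (⊕-self 0v) }) , (λ { [] [] _ → refl }) ,
  λ { [] []≢0 → ⊥-elim ([]≢0 refl) }

HasFlatAvoiding-lift : ∀ {d m n} (M : Matroid n) (N : Matroid m) →
  ContainsInduced M N → HasFlatAvoiding N d → HasFlatAvoiding M d
HasFlatAvoiding-lift _ _
  (φ , φ-linear , φ-injective , φ-restricts) (ψ , ψ-linear , ψ-injective , ψ-avoids) =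
  φ ∘ ψ , ∘-linear φ-linear ψ-linear , ∘-injective φ-injective ψ-injective ,
  λ x x≢0 → trans (sym (φ-restricts (ψ x) (embedding-≢0v ψ-linear ψ-injective x≢0)))
                  (ψ-avoids x x≢0)

HasFlatOfCodim : ∀ {n} → Matroid n → ℕ → Set
HasFlatOfCodim {n} M k = Σ ℕ λ d → (d + k ≡ n) × HasFlatAvoiding M d

HasFlatOfCodim-dim : ∀ {n} (M : Matroid n) → HasFlatOfCodim M n
HasFlatOfCodim-dim M = 0 , refl , HasFlatAvoiding-zero M

Isomorphic⇒HasFlatOfCodim⇔ : ∀ {n k} (M N : Matroid n) →
  Isomorphic M N → HasFlatOfCodim M k ⇔ HasFlatOfCodim N k
Isomorphic⇒HasFlatOfCodim⇔ M N M≅N = mk⇔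
  (λ (d , d+k≡n , flat) → d , d+k≡n , HasFlatAvoiding-lift N M N⊇M flat)
  (λ (d , d+k≡n , flat) → d , d+k≡n , HasFlatAvoiding-lift M N M⊇N flat)
  where
  M⊇N : ContainsInduced M N
  M⊇N = Isomorphic⇒ContainsInduced M N M≅N
  N⊇M : ContainsInduced N M
  N⊇M = Isomorphic⇒ContainsInduced N M (Isomorphic-sym M N M≅N)

IsLeast : (ℕ → Set) → ℕ → Set
IsLeast P k = P k × (∀ j → j < k → ¬ P j)

IsCriticalNumber⇔IsLeast : ∀ {n k} (M : Matroid n) →
  IsCriticalNumber M k ⇔ IsLeast (HasFlatOfCodim M) k
IsCriticalNumber⇔IsLeast M = mk⇔
  (λ (flat , least) → flat , λ j j<k (d , d+j≡n , flat′) → least j d j<k d+j≡n flat′)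
  (λ (flat , least) → flat , λ j d j<k d+j≡n flat′ → least j j<k (d , d+j≡n , flat′))

IsLeast-≤ : ∀ {P : ℕ → Set} {c k} → P c → IsLeast P k → k ≤ c
IsLeast-≤ {c = c} pc (_ , least) = ≮⇒≥ (λ c<k → least c c<k pc)

IsLeast-transfer : ∀ {P Q : ℕ → Set} {c k} → P c → (∀ j → j ≤ c → P j ⇔ Q j) →
  IsLeast P k → IsLeast Q k
IsLeast-transfer {c = c} {k} pc P⇔Q leastP@(pk , least) =
  to (P⇔Q k k≤c) pk , λ j j<k qj → least j j<k (from (P⇔Q j (≤-trans (<⇒≤ j<k) k≤c)) qj)
  where
  open Equivalence
  k≤c : k ≤ c
  k≤c = IsLeast-≤ pc leastP

IsLeast-cong≤ : ∀ {P Q : ℕ → Set} {c k} → P c → (∀ j → j ≤ c → P j ⇔ Q j) →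
  IsLeast P k ⇔ IsLeast Q k
IsLeast-cong≤ {c = c} pc P⇔Q = mk⇔ (IsLeast-transfer pc P⇔Q)
  (IsLeast-transfer (Equivalence.to (P⇔Q c ≤-refl) pc) (λ j j≤c → ⇔-sym (P⇔Q j j≤c)))

-- The doubling

double-flat-suc : ∀ {d n} (M₀ : Matroid n) →
  HasFlatAvoiding M₀ d → HasFlatAvoiding (double M₀) (suc d)
double-flat-suc M₀ (ψ , ψ-linear , ψ-injective , ψ-avoids) =
  cons-map ψ , cons-map-linear ψ-linear , cons-map-injective ψ-injective ,
  λ { (_ ∷ x) _ → agree-off-0v⇒agree (E M₀ ∘ ψ) (λ _ → false) ψ-avoids
                    (trans (cong (E M₀) (linear-0v ψ-linear)) (E-zero M₀)) x }

double-flat-pred : ∀ {d n} (M₀ : Matroid n) →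
  HasFlatAvoiding (double M₀) (suc d) → HasFlatAvoiding M₀ d
double-flat-pred M₀ (ψ , ψ-linear , ψ-injective , ψ-avoids)
  with hyperplane-avoiding-e₀ ψ-linear ψ-injective
... | a , a-linear , a-injective , avoids-e₀ =
  tail ∘ ψ ∘ a , tail∘-linear ψa-linear ,
  tail∘-injective ψa-linear (∘-injective ψ-injective a-injective) avoids-e₀ ,
  λ z z≢0 → trans (sym (E-double M₀ (ψ (a z))))
                  (ψ-avoids (a z) (embedding-≢0v a-linear a-injective z≢0))
  where
  ψa-linear : IsLinear (ψ ∘ a)
  ψa-linear = ∘-linear ψ-linear a-linear

double-HasFlatOfCodim⇔ : ∀ {n k} (M₀ : Matroid n) → k ≤ n →
  HasFlatOfCodim M₀ k ⇔ HasFlatOfCodim (double M₀) k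
double-HasFlatOfCodim⇔ {n} {k} M₀ k≤n = mk⇔
  (λ (d , d+k≡n , flat) → suc d , cong suc d+k≡n , double-flat-suc M₀ flat)
  λ { (zero , k≡1+n , _) → ⊥-elim (1+n≰n (subst (_≤ n) k≡1+n k≤n))
    ; (suc d , 1+d+k≡1+n , flat) → d , suc-injective 1+d+k≡1+n , double-flat-pred M₀ flat }

translation-invariant⇒doubling : ∀ {m} (N : Matroid m) (x₀ : F2^ m) → x₀ ≢ 0v →
  (∀ w → E N (x₀ ⊕ w) ≡ E N w) → Σ ℕ λ m₀ → Σ (Matroid m₀) (IsDoublingOf N)
translation-invariant⇒doubling {zero} N [] x₀≢0 _ = ⊥-elim (x₀≢0 refl)
translation-invariant⇒doubling {suc m} N x₀ x₀≢0 invariant with automorphism-e₀↦ x₀ x₀≢0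
... | θ , θe₀≡x₀ = m , N₀ , to , linear , injective , surjective , restricts
  where
  open Automorphism θ
  N₀ : Matroid m
  N₀ = record
    { E      = E N ∘ to ∘ (false ∷_)
    ; E-zero = trans (cong (E N) (linear-0v linear)) (E-zero N)
    }
  restricts : RestrictsVia N (double N₀) to
  restricts (false ∷ z) _ = refl
  restricts (true ∷ z) _ = begin
    E N (to (false ∷ z))                ≡⟨ sym (invariant _) ⟩
    E N (x₀ ⊕ to (false ∷ z))           ≡⟨ cong (λ u → E N (u ⊕ to (false ∷ z))) (sym θe₀≡x₀) ⟩
    E N (to e₀ ⊕ to (false ∷ z))        ≡⟨ cong (E N) (sym (linear e₀ (false ∷ z))) ⟩
    E N (to (true ∷ (0v ⊕ z)))          ≡⟨ cong (E N ∘ to ∘ (true ∷_)) (⊕-identityˡ z) ⟩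
    E N (to (true ∷ z))                 ∎
    where open ≡-Reasoning

restriction-of-double : ∀ {m n} (M₀ : Matroid n) (N : Matroid m) → ContainsInduced (double M₀) N →
  ContainsInduced M₀ N ⊎ Σ ℕ λ m₀ → Σ (Matroid m₀) (IsDoublingOf N)
restriction-of-double M₀ N (ρ , ρ-linear , ρ-injective , ρ-restricts)
  with ∃? (λ x → ρ x ≡ e₀) (λ x → ρ x ≟v e₀)
... | no ∄x = inj₁
  ( tail ∘ ρ , tail∘-linear ρ-linear , tail∘-injective ρ-linear ρ-injective (λ x → ∄x ∘ (x ,_))
  , λ x x≢0 → trans (ρ-restricts x x≢0) (E-double M₀ (ρ x)) )
... | yes (x₀ , ρx₀≡e₀) =
  inj₂ (translation-invariant⇒doubling N x₀ (preimage-≢0v ρ-linear ρx₀≡e₀ e₀≢0v) invariant)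
  where
  E-N≡ : ∀ x → E N x ≡ E (double M₀) (ρ x)
  E-N≡ = restricts-everywhere (double M₀) N ρ-linear ρ-restricts
  invariant : ∀ w → E N (x₀ ⊕ w) ≡ E N w
  invariant w = begin
    E N (x₀ ⊕ w)                 ≡⟨ E-N≡ (x₀ ⊕ w) ⟩
    E (double M₀) (ρ (x₀ ⊕ w))   ≡⟨ cong (E (double M₀)) (ρ-linear x₀ w) ⟩
    E (double M₀) (ρ x₀ ⊕ ρ w)   ≡⟨ cong (λ u → E (double M₀) (u ⊕ ρ w)) ρx₀≡e₀ ⟩
    E (double M₀) (e₀ ⊕ ρ w)     ≡⟨ E-double-⊕e₀ M₀ (ρ w) ⟩
    E (double M₀) (ρ w)          ≡⟨ sym (E-N≡ w) ⟩
    E N w                        ∎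
    where open ≡-Reasoning

lemma2p2 : ∀ {n₀ n} (M₀ : Matroid n₀) (M : Matroid n) → IsDoublingOf M M₀ →
    (∀ k → IsCriticalNumber M k ⇔ IsCriticalNumber M₀ k)
    × (∀ {m} (N : Matroid m) → NotADoubling N →
        ¬ ContainsInduced M₀ N → ¬ ContainsInduced M N)
lemma2p2 M₀ M M≅2M₀ with Isomorphic⇒dim≡ M (double M₀) M≅2M₀
... | refl = critical , excluded
  where
  critical : ∀ k → IsCriticalNumber M k ⇔ IsCriticalNumber M₀ k
  critical k = ⇔-sym (IsCriticalNumber⇔IsLeast M₀) ⇔-∘ (⇔-sym least⇔ ⇔-∘ IsCriticalNumber⇔IsLeast M)
    where
    least⇔ : IsLeast (HasFlatOfCodim M₀) k ⇔ IsLeast (HasFlatOfCodim M) k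
    least⇔ = IsLeast-cong≤ (HasFlatOfCodim-dim M₀) λ j j≤n₀ →
      ⇔-sym (Isomorphic⇒HasFlatOfCodim⇔ M (double M₀) M≅2M₀) ⇔-∘ double-HasFlatOfCodim⇔ M₀ j≤n₀

  2M₀⊇M : ContainsInduced (double M₀) M
  2M₀⊇M = Isomorphic⇒ContainsInduced (double M₀) M (Isomorphic-sym M (double M₀) M≅2M₀)

  excluded : ∀ {m} (N : Matroid m) → NotADoubling N → ¬ ContainsInduced M₀ N → ¬ ContainsInduced M N
  excluded N N-not-doubling M₀⊉N M⊇N
    with restriction-of-double M₀ N (ContainsInduced-trans (double M₀) M N 2M₀⊇M M⊇N)
  ... | inj₁ M₀⊇N = M₀⊉N M₀⊇N
  ... | inj₂ (m₀ , N₀ , N≅2N₀) = N-not-doubling m₀ N₀ N≅2N₀
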